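{- An odd composite positive integer $n>1$ is a super Carmichael number if and only if $$2\sum_{i=1}^{\varphi(n)/2} r_i^{\,n-1}+n\sum_{i=1}^{\varphi(n)/2} r_i^{\,n-2}\equiv \varphi(n)\pmod{n^2},$$ where $r_1<r_2<\cdots<r_{\varphi(n)}$ are all the integers $r$ with $1\le r\le n-1$ and $\gcd(r,n)=1$.
   Context: $\varphi$ is Euler's totient function. A composite positive integer $n$ is called a weak Carmichael number if $\sum_{1\le k\le n-1,\ \gcd(k,n)=1} k^{n-1}\equiv \varphi(n)\pmod{n}$. A weak Carmichael number $n$ is called a super Carmichael number if $\sum_{1\le k\le n-1,\ \gcd(k,n)=1} k^{n-1}\equiv \varphi(n)\pmod{n^2}$. -}

module Defs where

open import Data.Nat using (ℕ; suc; _+_; _*_; _∸_; _^_; _/_)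
open import Data.Nat.GCD using (gcd)
open import Data.Nat.Coprimality using (Coprime; coprime?)
open import Data.Nat.Primality using (Composite)
open import Data.List using (List; filter; length; map; take; drop; upTo)
open import Data.Nat.ListAction using (sum)
open import Data.Product using (_×_)
open import Data.Integer as ℤ using (ℤ; +_)
open import Data.Integer.Divisibility as ℤD using ()

reducedResidues : ℕ → List ℕ
reducedResidues n = filter (λ k → coprime? k n) (drop 1 (upTo n))

-- Euler's totient function: number of 1 ≤ k ≤ n with gcd(k,n)=1
-- (for n ≥ 2 this equals the number of reduced residues in [1, n-1])
φ : ℕ → ℕ
φ n = length (filter (λ k → coprime? k n) (map suc (upTo n)))

_≡_[mod_] : ℕ → ℕ → ℕ → Set
a ≡ b [mod m ] = (+ m) ℤD.∣ ((+ a) ℤ.- (+ b))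

powerSum : ℕ → ℕ
powerSum n = sum (map (λ k → k ^ (n ∸ 1)) (reducedResidues n))

WeakCarmichael : ℕ → Set
WeakCarmichael n = Composite n × (powerSum n ≡ φ n [mod n ])

SuperCarmichael : ℕ → Set
SuperCarmichael n = WeakCarmichael n × (powerSum n ≡ φ n [mod n * n ])

lowerHalf : ℕ → List ℕ
lowerHalf n = take (φ n / 2) (reducedResidues n)

-- Reduced residues mod an odd n come in pairs r, n - r, and the ordered list of them is the
-- first half followed by the reflections of that half in reverse order. Hence the power sum
-- is the sum over the lower half of r^(n-1) + (n - r)^(n-1). Since n - 1 is even,
-- (n - r)^(n-1) = (r - n)^(n-1) ≡ r^(n-1) - (n - 1) n r^(n-2) ≡ r^(n-1) + n r^(n-2) (mod n²)
-- by the binomial theorem, so the power sum is congruent mod n² to the displayed expression.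
-- The condition mod n in the definition of a super Carmichael number follows from the one mod n².
module Submission where

open import Defs
open import Level using (Level)
import Data.Nat as ℕ
open ℕ using (ℕ; zero; suc; _∸_; _≤_; _<_; _%_; _/_; s≤s; z≤n; _≤?_)
import Data.Nat.Properties as ℕP
open import Data.Nat.DivMod using (m≡m%n+[m/n]*n; m%n<n; m/n≤m; m*n%n≡0)
import Data.Nat.Divisibility as ℕD
open import Data.Nat.Coprimality using (Coprime; coprime?)
open import Data.Nat.Primality using (Composite)
open import Data.Nat.ListAction using (sum)
open import Data.Nat.ListAction.Properties using (sum-++; sum-↭)
open import Data.List
  using (List; []; _∷_; _++_; [_]; map; filter; reverse; take; drop; length; upTo; applyUpTo; applyDownFrom)
open import Data.List.Properties
  using (∷-injectiveˡ; ∷-injectiveʳ; ++-identityʳ; ∷ʳ-++; map-++; map-∘; length-map; length-take; length-drop;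
         take++drop≡id; map-applyUpTo; applyUpTo-∷ʳ; reverse-applyUpTo; unfold-reverse; reverse-++;
         reverse-involutive; length-reverse; reverse-map; filter-accept; filter-reject; filter-++)
open import Data.List.Relation.Unary.All using (All; []; _∷_)
import Data.List.Relation.Unary.All as All
open import Data.List.Relation.Unary.All.Properties using (applyUpTo⁺₁; filter⁺; take⁺)
open import Data.List.Relation.Binary.Permutation.Propositional.Properties using (↭-reverse)
open import Data.Product using (_×_; _,_; proj₁; proj₂; ∃-syntax)
open import Data.Sum using (_⊎_; inj₁; inj₂)
open import Function.Base using (_∘_)
open import Function.Bundles using (_⇔_; mk⇔; Equivalence)
open import Relation.Nullary using (¬_; yes; no; contradiction)
open import Relation.Unary using (Pred; Decidable)
open import Relation.Binary.PropositionalEquality hiding ([_])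
open ≡-Reasoning

private variable
  a p : Level
  A : Set a

m*2≡m+m : ∀ m → m ℕ.* 2 ≡ m ℕ.+ m
m*2≡m+m m = trans (ℕP.*-comm m 2) (cong (m ℕ.+_) (ℕP.+-identityʳ m))

n%2≡1⇒n≡1+n/2+n/2 : ∀ {n} → n % 2 ≡ 1 → n ≡ suc (n / 2 ℕ.+ n / 2)
n%2≡1⇒n≡1+n/2+n/2 {n} odd = trans (m≡m%n+[m/n]*n n 2) (cong₂ ℕ._+_ odd (m*2≡m+m (n / 2)))

odd>1⇒n≡3+2i : ∀ {n} → 1 < n → n % 2 ≡ 1 → ∃[ i ] n ≡ suc (suc i ℕ.+ suc i)
odd>1⇒n≡3+2i {n} 1<n odd with n / 2 | n%2≡1⇒n≡1+n/2+n/2 {n} odd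
... | zero  | refl = contradiction 1<n (ℕP.<-irrefl refl)
... | suc i | n≡   = i , n≡

module _ where
  open import Data.Integer using (ℤ; +_; _+_; _*_; _-_; -_; _^_; 0ℤ; 1ℤ)
  open import Data.Integer.Properties using (pos-+; pos-*; m-n≡m⊖n; ⊖-≥; +-inverseʳ; *-zeroˡ; ∣i-j∣≡∣j-i∣)
  open import Data.Integer.Divisibility.Signed as S using (divides)
  open import Data.Integer.Tactic.RingSolver using (solve-∀)

  pos-^ : ∀ a k → + (a ℕ.^ k) ≡ (+ a) ^ k
  pos-^ a zero    = refl
  pos-^ a (suc k) = trans (pos-* a (a ℕ.^ k)) (cong (+ a *_) (pos-^ a k))

  pos-∸ : ∀ {a n} → a ≤ n → + (n ∸ a) ≡ + n - + a
  pos-∸ {a} {n} a≤n = sym (trans (m-n≡m⊖n n a) (⊖-≥ a≤n))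

  ^-neg-even : ∀ j z → (- z) ^ (j ℕ.+ j) ≡ z ^ (j ℕ.+ j)
  ^-neg-even zero    z = refl
  ^-neg-even (suc j) z = begin
    (- z) ^ (suc j ℕ.+ suc j)           ≡⟨ cong ((- z) ^_) (cong suc (ℕP.+-suc j j)) ⟩
    (- z) * ((- z) * (- z) ^ (j ℕ.+ j)) ≡⟨ cong (λ w → (- z) * ((- z) * w)) (^-neg-even j z) ⟩
    (- z) * ((- z) * z ^ (j ℕ.+ j))     ≡⟨ square-neg z (z ^ (j ℕ.+ j)) ⟩
    z * (z * z ^ (j ℕ.+ j))             ≡⟨ cong (z ^_) (cong suc (ℕP.+-suc j j)) ⟨
    z ^ (suc j ℕ.+ suc j)               ∎
    where
    square-neg : ∀ z w → (- z) * ((- z) * w) ≡ z * (z * w)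
    square-neg = solve-∀

  binomial-mod-square : ∀ m (x y : ℤ) →
    ∃[ q ] (x + y) ^ suc m ≡ x ^ suc m + + suc m * x ^ m * y + q * (y * y)
  binomial-mod-square zero    x y = 0ℤ , linear x y
    where
    linear : ∀ x y → (x + y) * 1ℤ ≡ x * 1ℤ + 1ℤ * 1ℤ * y + 0ℤ * (y * y)
    linear = solve-∀
  binomial-mod-square (suc m) x y with binomial-mod-square m x y
  ... | q , eq = x * q + + suc m * x ^ m + y * q , (begin
    (x + y) * (x + y) ^ suc m
      ≡⟨ cong ((x + y) *_) eq ⟩
    (x + y) * (x * x ^ m + + suc m * x ^ m * y + q * (y * y))
      ≡⟨ expand x y (x ^ m) (+ suc m) q ⟩
    x * (x * x ^ m) + (1ℤ + + suc m) * (x * x ^ m) * y + (x * q + + suc m * x ^ m + y * q) * (y * y) ∎)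
    where
    expand : ∀ x y X C q → (x + y) * (x * X + C * X * y + q * (y * y)) ≡
             x * (x * X) + (1ℤ + C) * (x * X) * y + (x * q + C * X + y * q) * (y * y)
    expand = solve-∀

  even-power-reflection : ∀ i (a n : ℤ) → let e = suc i ℕ.+ suc i in
    ∃[ q ] (n - a) ^ e ≡ a ^ e - + e * a ^ (i ℕ.+ suc i) * n + q * (n * n)
  even-power-reflection i a n with binomial-mod-square (i ℕ.+ suc i) a (- n)
  ... | q , eq = q , (begin
    (n - a) ^ e                                                     ≡⟨ cong (_^ e) (swap n a) ⟩
    (- (a + - n)) ^ e                                               ≡⟨ ^-neg-even (suc i) (a + - n) ⟩
    (a + - n) ^ e                                                   ≡⟨ eq ⟩
    a ^ e + + e * a ^ (i ℕ.+ suc i) * (- n) + q * ((- n) * (- n))   ≡⟨ tidy (a ^ e) (+ e) (a ^ (i ℕ.+ suc i)) n q ⟩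
    a ^ e - + e * a ^ (i ℕ.+ suc i) * n + q * (n * n)               ∎)
    where
    e = suc i ℕ.+ suc i
    swap : ∀ n a → n - a ≡ - (a + - n)
    swap = solve-∀
    tidy : ∀ A E X n q → A + E * X * (- n) + q * ((- n) * (- n)) ≡ A - E * X * n + q * (n * n)
    tidy = solve-∀

  ∣⇒≡[mod] : ∀ {m a b} → + m S.∣ + a - + b → a ≡ b [mod m ]
  ∣⇒≡[mod] = S.∣⇒∣ᵤ

  ≡[mod]⇒∣ : ∀ {m a b} → a ≡ b [mod m ] → + m S.∣ + a - + b
  ≡[mod]⇒∣ {m} {a} {b} = S.∣ᵤ⇒∣ {+ m} {+ a - + b}

  ≡[mod]-refl : ∀ {m a} → a ≡ a [mod m ]
  ≡[mod]-refl {m} {a} = ∣⇒≡[mod] {m} {a} {a} (divides 0ℤ (trans (+-inverseʳ (+ a)) (sym (*-zeroˡ (+ m)))))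

  ≡[mod]-sym : ∀ {m a b} → a ≡ b [mod m ] → b ≡ a [mod m ]
  ≡[mod]-sym {m} {a} {b} a≡b = subst (_ ℕD.∣_) (∣i-j∣≡∣j-i∣ (+ a) (+ b)) a≡b

  ≡[mod]-trans : ∀ {m a b c} → a ≡ b [mod m ] → b ≡ c [mod m ] → a ≡ c [mod m ]
  ≡[mod]-trans {m} {a} {b} {c} a≡b b≡c = ∣⇒≡[mod] {m} {a} {c}
    (subst (+ m S.∣_) (telescope (+ a) (+ b) (+ c)) (S.∣m∣n⇒∣m+n (≡[mod]⇒∣ {m} {a} {b} a≡b) (≡[mod]⇒∣ {m} {b} {c} b≡c)))
    where
    telescope : ∀ a b c → (a - b) + (b - c) ≡ a - c
    telescope = solve-∀

  +-cong-≡[mod] : ∀ {m a b c d} → a ≡ b [mod m ] → c ≡ d [mod m ] → (a ℕ.+ c) ≡ (b ℕ.+ d) [mod m ]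
  +-cong-≡[mod] {m} {a} {b} {c} {d} a≡b c≡d = ∣⇒≡[mod] {m} {a ℕ.+ c} {b ℕ.+ d}
    (subst (+ m S.∣_) regroup (S.∣m∣n⇒∣m+n (≡[mod]⇒∣ {m} {a} {b} a≡b) (≡[mod]⇒∣ {m} {c} {d} c≡d)))
    where
    shuffle : ∀ a b c d → (a - b) + (c - d) ≡ (a + c) - (b + d)
    shuffle = solve-∀
    regroup : (+ a - + b) + (+ c - + d) ≡ + (a ℕ.+ c) - + (b ℕ.+ d)
    regroup = trans (shuffle (+ a) (+ b) (+ c) (+ d)) (sym (cong₂ _-_ (pos-+ a c) (pos-+ b d)))

  ≡[mod]-∣ : ∀ {m d a b} → d ℕD.∣ m → a ≡ b [mod m ] → a ≡ b [mod d ]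
  ≡[mod]-∣ = ℕD.∣-trans

  reflected-power-≡ : ∀ {n a} → 1 < n → n % 2 ≡ 1 → a ≤ n →
    (a ℕ.^ (n ∸ 1) ℕ.+ (n ∸ a) ℕ.^ (n ∸ 1)) ≡ (2 ℕ.* a ℕ.^ (n ∸ 1) ℕ.+ n ℕ.* a ℕ.^ (n ∸ 2)) [mod n ℕ.* n ]
  reflected-power-≡ {n} {a} 1<n odd a≤n with odd>1⇒n≡3+2i 1<n odd
  ... | i , refl with even-power-reflection i (+ a) (+ n)
  ... | q , eq = ∣⇒≡[mod] {n ℕ.* n} {aᵉ ℕ.+ bᵉ} {2 ℕ.* aᵉ ℕ.+ n ℕ.* aᵐ} (divides (q - xᵐ) (begin
    + (aᵉ ℕ.+ bᵉ) - + (2 ℕ.* aᵉ ℕ.+ n ℕ.* aᵐ)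
      ≡⟨ cong₂ _-_ (pos-+ aᵉ bᵉ) (trans (pos-+ (2 ℕ.* aᵉ) (n ℕ.* aᵐ)) (cong₂ _+_ (pos-* 2 aᵉ) (pos-* n aᵐ))) ⟩
    (+ aᵉ + + bᵉ) - (+ 2 * + aᵉ + + n * + aᵐ)
      ≡⟨ cong₂ (λ u v → (u + v) - (+ 2 * u + + n * + aᵐ)) (pos-^ a e) (trans (pos-^ (n ∸ a) e) (cong (_^ e) (pos-∸ a≤n))) ⟩
    (x ^ e + (+ n - x) ^ e) - (+ 2 * x ^ e + + n * + aᵐ)
      ≡⟨ cong₂ (λ u w → (x ^ e + u) - (+ 2 * x ^ e + + n * w)) eq (pos-^ a (i ℕ.+ suc i)) ⟩
    (x ^ e + (x ^ e - + e * xᵐ * + n + q * (+ n * + n))) - (+ 2 * x ^ e + + n * xᵐ)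
      ≡⟨ collect x xᵐ (+ e) q ⟩
    (q - xᵐ) * (+ n * + n)
      ≡⟨ cong ((q - xᵐ) *_) (pos-* n n) ⟨
    (q - xᵐ) * + (n ℕ.* n) ∎))
    where
    e = suc i ℕ.+ suc i
    x = + a
    xᵐ = x ^ (i ℕ.+ suc i)
    aᵉ = a ℕ.^ e
    bᵉ = (n ∸ a) ℕ.^ e
    aᵐ = a ℕ.^ (i ℕ.+ suc i)
    -- n = 1 + e, so the linear term - e xᵐ n is n xᵐ - n² xᵐ.
    collect : ∀ x X E q →
      (x * X + (x * X - E * X * (1ℤ + E) + q * ((1ℤ + E) * (1ℤ + E)))) - (+ 2 * (x * X) + (1ℤ + E) * X)
        ≡ (q - X) * ((1ℤ + E) * (1ℤ + E))
    collect = solve-∀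

-- The ℕ operators are opened unqualified only now; above they would clash with those of ℤ.
open import Data.Nat using (_+_; _*_; _^_)

++-injective : ∀ (xs ys us vs : List A) → length xs ≡ length us → xs ++ ys ≡ us ++ vs → xs ≡ us × ys ≡ vs
++-injective []       ys []       vs _   eq = refl , eq
++-injective (x ∷ xs) ys (u ∷ us) vs len eq with ++-injective xs ys us vs (ℕP.suc-injective len) (∷-injectiveʳ eq)
... | xs≡us , ys≡vs = cong₂ _∷_ (∷-injectiveˡ eq) xs≡us , ys≡vs

module _ {P : Pred A p} (P? : Decidable P) where

  filter-reverse : ∀ xs → filter P? (reverse xs) ≡ reverse (filter P? xs)
  filter-reverse []       = refl
  filter-reverse (x ∷ xs) = begin
    filter P? (reverse (x ∷ xs))                         ≡⟨ cong (filter P?) (unfold-reverse x xs) ⟩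
    filter P? (reverse xs ++ [ x ])                      ≡⟨ filter-++ P? (reverse xs) [ x ] ⟩
    filter P? (reverse xs) ++ filter P? [ x ]            ≡⟨ cong₂ _++_ (filter-reverse xs) filter-[x]-palindrome ⟩
    reverse (filter P? xs) ++ reverse (filter P? [ x ])  ≡⟨ reverse-++ (filter P? [ x ]) (filter P? xs) ⟨
    reverse (filter P? [ x ] ++ filter P? xs)            ≡⟨ cong reverse (filter-++ P? [ x ] xs) ⟨
    reverse (filter P? (x ∷ xs))                         ∎
    where
    filter-[x]-palindrome : filter P? [ x ] ≡ reverse (filter P? [ x ])
    filter-[x]-palindrome with P? x
    ... | yes _ = refl
    ... | no  _ = refl

  filter-map-comm : (g : A → A) → ∀ {xs} → All (λ x → P x ⇔ P (g x)) xs →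
    filter P? (map g xs) ≡ map g (filter P? xs)
  filter-map-comm g []                          = refl
  filter-map-comm g {x ∷ xs} (Px⇔Pgx ∷ P⇔P∘g) with P? x
  ... | yes Px  = trans (filter-accept P? (Equivalence.to Px⇔Pgx Px))
                        (cong (g x ∷_) (filter-map-comm g P⇔P∘g))
  ... | no  ¬Px = trans (filter-reject P? (λ Pgx → ¬Px (Equivalence.from Px⇔Pgx Pgx)))
                        (filter-map-comm g P⇔P∘g)

m∸m/2≡m/2⊎1+m/2 : ∀ m → m ∸ m / 2 ≡ m / 2 ⊎ m ∸ m / 2 ≡ suc (m / 2)
m∸m/2≡m/2⊎1+m/2 m with m % 2 | m≡m%n+[m/n]*n m 2 | m%n<n m 2
... | 0 | m≡ | _ = inj₁ (trans (cong (_∸ m / 2) (trans m≡ (m*2≡m+m (m / 2)))) (ℕP.m+n∸m≡n (m / 2) (m / 2)))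
... | 1 | m≡ | _ = inj₂ (trans (cong (_∸ m / 2) (trans m≡ (cong suc (m*2≡m+m (m / 2)))))
                          (trans (ℕP.+-∸-assoc 1 (ℕP.m≤m+n (m / 2) (m / 2))) (cong suc (ℕP.m+n∸m≡n (m / 2) (m / 2)))))
... | suc (suc _) | _ | s≤s (s≤s ())

module _ (g : A → A) (g-fixpoint-free : ∀ x → g x ≢ x) where

  private
    swap-halves : ∀ xs ys → map g (xs ++ ys) ≡ reverse (xs ++ ys) → map g xs ++ map g ys ≡ reverse ys ++ reverse xs
    swap-halves xs ys reflect = trans (sym (map-++ g xs ys)) (trans reflect (reverse-++ xs ys))

  -- A fixed point of g would sit in the middle of an odd-length g-palindrome.
  reflection-halves : ∀ xs ys → length ys ≡ length xs ⊎ length ys ≡ suc (length xs) →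
    map g (xs ++ ys) ≡ reverse (xs ++ ys) → ys ≡ reverse (map g xs)
  reflection-halves xs ys (inj₁ same) reflect =
    trans (sym (reverse-involutive ys))
          (cong reverse (sym (proj₁ (++-injective (map g xs) _ (reverse ys) _ len (swap-halves xs ys reflect)))))
    where
    len : length (map g xs) ≡ length (reverse ys)
    len = trans (length-map g xs) (trans (sym same) (sym (length-reverse ys)))
  reflection-halves xs (y ∷ ys) (inj₂ one-more) reflect =
    contradiction (∷-injectiveˡ (proj₂ (++-injective (map g xs) _ (reverse ys) _ len halves))) (g-fixpoint-free y)
    where
    len : length (map g xs) ≡ length (reverse ys)
    len = trans (length-map g xs) (trans (sym (ℕP.suc-injective one-more)) (sym (length-reverse ys)))
    halves : map g xs ++ g y ∷ map g ys ≡ reverse ys ++ y ∷ reverse xs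
    halves = trans (swap-halves xs (y ∷ ys) reflect)
      (trans (cong (_++ reverse xs) (unfold-reverse y ys)) (∷ʳ-++ (reverse ys) y (reverse xs)))

  drop-half≡reverse-map-take-half : ∀ zs → map g zs ≡ reverse zs →
    drop (length zs / 2) zs ≡ reverse (map g (take (length zs / 2) zs))
  drop-half≡reverse-map-take-half zs reflect = reflection-halves (take h zs) (drop h zs) lengths
    (subst (λ ws → map g ws ≡ reverse ws) (sym (take++drop≡id h zs)) reflect)
    where
    h = length zs / 2
    length-take-half : length (take h zs) ≡ h
    length-take-half = trans (length-take h zs) (ℕP.m≤n⇒m⊓n≡m (m/n≤m (length zs) 2))
    lengths : length (drop h zs) ≡ length (take h zs) ⊎ length (drop h zs) ≡ suc (length (take h zs))
    lengths rewrite length-drop h zs | length-take-half = m∸m/2≡m/2⊎1+m/2 (length zs)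

sum-reverse : ∀ ns → sum (reverse ns) ≡ sum ns
sum-reverse ns = sum-↭ (↭-reverse ns)

sum-map-+ : ∀ (f g : A → ℕ) xs → sum (map (λ x → f x + g x) xs) ≡ sum (map f xs) + sum (map g xs)
sum-map-+ f g []       = refl
sum-map-+ f g (x ∷ xs) = trans (cong (f x + g x +_) (sum-map-+ f g xs)) (+-interchange (f x) (g x) _ _)
  where open import Algebra.Properties.CommutativeSemigroup ℕP.+-commutativeSemigroup renaming (interchange to +-interchange)

sum-map-* : ∀ c (f : A → ℕ) xs → sum (map (λ x → c * f x) xs) ≡ c * sum (map f xs)
sum-map-* c f []       = sym (ℕP.*-zeroʳ c)
sum-map-* c f (x ∷ xs) =
  trans (cong (c * f x +_) (sum-map-* c f xs)) (sym (ℕP.*-distribˡ-+ c (f x) (sum (map f xs))))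

sum-cong-≡[mod] : ∀ {m} (f g : A → ℕ) {xs} → All (λ x → f x ≡ g x [mod m ]) xs →
  sum (map f xs) ≡ sum (map g xs) [mod m ]
sum-cong-≡[mod] f g {[]}     []              = ≡[mod]-refl {a = 0}
sum-cong-≡[mod] f g {x ∷ xs} (fx≡gx ∷ fs≡gs) =
  +-cong-≡[mod] {a = f x} {g x} {sum (map f xs)} {sum (map g xs)} fx≡gx (sum-cong-≡[mod] f g fs≡gs)

coprime-∸ : ∀ {m n} → m ≤ n → Coprime m n → Coprime (n ∸ m) n
coprime-∸ {m} m≤n coprime (d∣n∸m , d∣n) =
  coprime (ℕD.∣m+n∣m⇒∣n (subst (_ ℕD.∣_) (sym (ℕP.m∸n+n≡m m≤n)) d∣n) d∣n∸m , d∣n)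

coprime⇔coprime-∸ : ∀ {m n} → m ≤ n → Coprime m n ⇔ Coprime (n ∸ m) n
coprime⇔coprime-∸ {m} {n} m≤n = mk⇔ (coprime-∸ m≤n)
  (λ coprime → subst (λ k → Coprime k n) (ℕP.m∸[m∸n]≡n m≤n) (coprime-∸ (ℕP.m∸n≤m n m) coprime))

applyUpTo-∸≡applyDownFrom-suc : ∀ m → applyUpTo (m ∸_) m ≡ applyDownFrom suc m
applyUpTo-∸≡applyDownFrom-suc zero    = refl
applyUpTo-∸≡applyDownFrom-suc (suc m) = cong (suc m ∷_) (applyUpTo-∸≡applyDownFrom-suc m)

reducedResidues-reflect : ∀ n → map (n ∸_) (reducedResidues n) ≡ reverse (reducedResidues n)
reducedResidues-reflect zero    = refl
reducedResidues-reflect (suc m) = begin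
  map (n ∸_) (filter P? D)         ≡⟨ filter-map-comm P? (n ∸_) (applyUpTo⁺₁ suc m (coprime⇔coprime-∸ ∘ ℕP.m≤n⇒m≤1+n)) ⟨
  filter P? (map (n ∸_) D)         ≡⟨ cong (filter P?) (trans (map-applyUpTo suc (n ∸_) m) (applyUpTo-∸≡applyDownFrom-suc m)) ⟩
  filter P? (applyDownFrom suc m)  ≡⟨ cong (filter P?) (reverse-applyUpTo suc m) ⟨
  filter P? (reverse D)            ≡⟨ filter-reverse P? D ⟩
  reverse (filter P? D)            ∎
  where
  n = suc m
  D = applyUpTo suc m
  P? = λ k → coprime? k n

reducedResidues<n : ∀ n → All (_< n) (reducedResidues n)
reducedResidues<n zero    = []
reducedResidues<n (suc m) = filter⁺ (λ k → coprime? k (suc m)) (applyUpTo⁺₁ suc m s≤s)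

φ≡length-reducedResidues : ∀ {n} → 1 < n → φ n ≡ length (reducedResidues n)
φ≡length-reducedResidues {suc m} (s≤s 1≤m) = cong length (begin
  filter P? (map suc (upTo n))                    ≡⟨ cong (filter P?) (map-applyUpTo (λ i → i) suc n) ⟩
  filter P? (applyUpTo suc n)                     ≡⟨ cong (filter P?) (applyUpTo-∷ʳ suc m) ⟨
  filter P? (applyUpTo suc m ++ [ n ])            ≡⟨ filter-++ P? (applyUpTo suc m) [ n ] ⟩
  filter P? (applyUpTo suc m) ++ filter P? [ n ]  ≡⟨ cong (filter P? (applyUpTo suc m) ++_) (filter-reject P? n-not-coprime) ⟩
  filter P? (applyUpTo suc m) ++ []               ≡⟨ ++-identityʳ _ ⟩
  filter P? (applyUpTo suc m)                     ∎)
  where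
  n = suc m
  P? = λ k → coprime? k n
  n-not-coprime : ¬ Coprime n n
  n-not-coprime coprime = ℕP.<⇒≢ (s≤s 1≤m) (sym (coprime (ℕD.∣-refl , ℕD.∣-refl)))

n%2≡1⇒n∸m≢m : ∀ {n} m → n % 2 ≡ 1 → n ∸ m ≢ m
n%2≡1⇒n∸m≢m {n} m odd n∸m≡m with m ≤? n
... | yes m≤n = ℕP.0≢1+n (begin
  0               ≡⟨ m*n%n≡0 m 2 ⟨
  (m * 2) % 2     ≡⟨ cong (_% 2) (trans (m*2≡m+m m) (cong (_+ m) (sym n∸m≡m))) ⟩
  (n ∸ m + m) % 2 ≡⟨ cong (_% 2) (ℕP.m∸n+n≡m m≤n) ⟩
  n % 2           ≡⟨ odd ⟩
  1               ∎)
... | no  m≰n = m≰n (subst (_≤ n) (trans (sym (ℕP.m≤n⇒m∸n≡0 (ℕP.≰⇒≥ m≰n))) n∸m≡m) z≤n)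

reducedResidues-halves : ∀ {n} → 1 < n → n % 2 ≡ 1 →
  reducedResidues n ≡ lowerHalf n ++ reverse (map (n ∸_) (lowerHalf n))
reducedResidues-halves {n} 1<n odd =
  subst (λ A → L ≡ A ++ reverse (map (n ∸_) A)) (sym lowerHalf≡take-half) (begin
    L                                            ≡⟨ take++drop≡id h L ⟨
    take h L ++ drop h L                         ≡⟨ cong (take h L ++_) (drop-half≡reverse-map-take-half (n ∸_)
                                                      (λ m → n%2≡1⇒n∸m≢m m odd) L (reducedResidues-reflect n)) ⟩
    take h L ++ reverse (map (n ∸_) (take h L))  ∎)
  where
  L = reducedResidues n
  h = length L / 2
  lowerHalf≡take-half : lowerHalf n ≡ take h L
  lowerHalf≡take-half = cong (λ k → take (k / 2) L) (φ≡length-reducedResidues 1<n)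

powerSum≡lowerHalf-sums : ∀ {n} → 1 < n → n % 2 ≡ 1 →
  powerSum n ≡ (2 * sum (map (λ r → r ^ (n ∸ 1)) (lowerHalf n))
                 + n * sum (map (λ r → r ^ (n ∸ 2)) (lowerHalf n))) [mod n * n ]
powerSum≡lowerHalf-sums {n} 1<n odd =
  subst₂ (λ u v → u ≡ v [mod n * n ]) (sym pairing) linearity
    (sum-cong-≡[mod] (λ r → f r + f (n ∸ r)) (λ r → 2 * f r + n * f₂ r)
      (All.map (reflected-power-≡ 1<n odd) lowerHalf≤n))
  where
  H = lowerHalf n
  f f₂ : ℕ → ℕ
  f r = r ^ (n ∸ 1)
  f₂ r = r ^ (n ∸ 2)
  lowerHalf≤n : All (_≤ n) H
  lowerHalf≤n = take⁺ (φ n / 2) (All.map ℕP.<⇒≤ (reducedResidues<n n))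
  pairing : powerSum n ≡ sum (map (λ r → f r + f (n ∸ r)) H)
  pairing = begin
    sum (map f (reducedResidues n))                   ≡⟨ cong (sum ∘ map f) (reducedResidues-halves 1<n odd) ⟩
    sum (map f (H ++ reverse (map (n ∸_) H)))         ≡⟨ cong sum (map-++ f H _) ⟩
    sum (map f H ++ map f (reverse (map (n ∸_) H)))   ≡⟨ sum-++ (map f H) _ ⟩
    sum (map f H) + sum (map f (reverse (map (n ∸_) H)))
      ≡⟨ cong (λ ns → sum (map f H) + sum ns) (reverse-map f (map (n ∸_) H)) ⟩
    sum (map f H) + sum (reverse (map f (map (n ∸_) H)))
      ≡⟨ cong (sum (map f H) +_) (trans (sum-reverse (map f (map (n ∸_) H))) (cong sum (sym (map-∘ H)))) ⟩
    sum (map f H) + sum (map (λ r → f (n ∸ r)) H)     ≡⟨ sum-map-+ f (λ r → f (n ∸ r)) H ⟨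
    sum (map (λ r → f r + f (n ∸ r)) H)               ∎
  linearity : sum (map (λ r → 2 * f r + n * f₂ r) H) ≡ 2 * sum (map f H) + n * sum (map f₂ H)
  linearity = trans (sum-map-+ (λ r → 2 * f r) (λ r → n * f₂ r) H) (cong₂ _+_ (sum-map-* 2 f H) (sum-map-* n f₂ H))

proposition2p60 : (n : ℕ) → 1 < n → n % 2 ≡ 1 → Composite n →
    (SuperCarmichael n ⇔
      ((2 * sum (map (λ r → r ^ (n ∸ 1)) (lowerHalf n))
         + n * sum (map (λ r → r ^ (n ∸ 2)) (lowerHalf n)))
        ≡ φ n [mod n * n ]))
proposition2p60 n 1<n odd composite = mk⇔
  (λ (_ , super) → ≡[mod]-trans {n * n} {halves} {powerSum n} {φ n} (≡[mod]-sym {n * n} {powerSum n} {halves} power≡halves) super)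
  (λ halves≡φ → let super = ≡[mod]-trans {n * n} {powerSum n} {halves} {φ n} power≡halves halves≡φ in
                (composite , ≡[mod]-∣ {n * n} {n} {powerSum n} {φ n} (ℕD.m∣m*n n) super) , super)
  where
  halves = 2 * sum (map (λ r → r ^ (n ∸ 1)) (lowerHalf n)) + n * sum (map (λ r → r ^ (n ∸ 2)) (lowerHalf n))
  power≡halves = powerSum≡lowerHalf-sums 1<n odd
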